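{- Let $r\ge1$ be an integer, let $F$ be a simple graph and let $H$ be an $(r+1)$-uniform hypergraph. Then \[ \hom(F^{(r)},H)=(r!)^{|E(F)|}\,\hom(F,B[H]), \] where $F^{(r)}$ is the $r$-intersection pattern hypergraph of $F$ and $B[H]$ is the vertex-vertex intersection graph of $H$.
   Context: A hypergraph homomorphism $F\to H$ is a map $\varphi:V(F)\to V(H)$ with $\{\varphi(v):v\in e\}\in E(H)$ for all $e\in E(F)$; $\hom(F,H)$ counts them. For an $(r+1)$-uniform hypergraph $H$ on vertex set $[n]$ the adjacency tensor is $A_{v_1,\dots,v_{r+1}}=1$ if $\{v_1,\dots,v_{r+1}\}\in E(H)$ and $0$ otherwise. The vertex-vertex intersection graph $B[H]$ is the weighted graph (possibly with loops) on $[n]$ with adjacency matrix $B_{uv}=\frac{1}{r!}\sum_{i_1,\dots,i_r=1}^nA_{u,i_1,\dots,i_r}A_{i_1,\dots,i_r,v}$ for all $u,v$. For a weighted graph $G$ with adjacency matrix $M$, $\hom(F,G)=\sum_{\varphi:V(F)\to V(G)}\prod_{\{u,v\}\in E(F)}M_{\varphi(u)\varphi(v)}$. The $r$-intersection pattern hypergraph $F^{(r)}$ of a graph $F=(V,E)$ is the $(r+1)$-uniform hypergraph with vertex set $V\cup\bigcup_{e\in E}\{w_{e,1},\dots,w_{e,r}\}$, where the $w_{e,i}$ are pairwise distinct new vertices, and with, for each edge $e=\{u,v\}\in E$, the two hyperedges $\{v,w_{e,1},\dots,w_{e,r}\}$ and $\{u,w_{e,1},\dots,w_{e,r}\}$.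 -}

module Defs where

open import Data.Bool using (Bool; true; false; T; if_then_else_; _∧_; _∨_)
open import Data.Nat as ℕ using (ℕ; zero; suc; _!; _<_)
open import Data.Nat.Properties using (_!≢0)
open import Data.Fin as Fin using (Fin; _↑ˡ_; _↑ʳ_; combine; _≟_)
open import Data.Fin.Subset using (Subset; ⁅_⁆; _∪_; ⋃; ∣_∣)
open import Data.Vec as Vec using (Vec; tabulate)
open import Data.Vec.Functional as VF using () renaming (_∷_ to _∷ᶠ_)
open import Data.List as List using (List; []; _∷_; length; allFin)
open import Data.List.Relation.Unary.All using (All)
open import Data.List.Relation.Unary.Unique.Propositional using (Unique)
open import Data.Product using (_×_; _,_)
open import Data.Integer using (+_)
open import Data.Rational as ℚ using (ℚ)
open import Relation.Nullary.Decidable using (⌊_⌋)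
open import Relation.Binary.PropositionalEquality using (_≡_)

module _ {A : Set} (_⊕_ : A → A → A) (ε : A) where

  sumFin : (n : ℕ) → (Fin n → A) → A
  sumFin n f = List.foldr (λ j acc → f j ⊕ acc) ε (allFin n)

  sumMaps : (m n : ℕ) → ((Fin m → Fin n) → A) → A
  sumMaps zero    n f = f (λ ())
  sumMaps (suc m) n f = sumFin n (λ j → sumMaps m n (λ g → f (j ∷ᶠ g)))

record SimpleGraph : Set where
  field
    V       : ℕ
    edges   : List (Fin V × Fin V)
    ordered : All (λ { (u , v) → u Fin.< v }) edges
    noDup   : Unique edges

open SimpleGraph public

numEdges : SimpleGraph → ℕ
numEdges F = length (edges F)

record UHypergraph (k : ℕ) : Set where
  field
    n       : ℕ
    E       : Subset n → Bool
    uniform : ∀ S → T (E S) → ∣ S ∣ ≡ k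

open UHypergraph public

image : {m n : ℕ} → (Fin m → Fin n) → Subset m → Subset n
image {m} φ S = tabulate (λ j →
  sumFin _∨_ false m (λ i → Vec.lookup S i ∧ ⌊ φ i ≟ j ⌋))

tupleSet : {k n : ℕ} → (Fin k → Fin n) → Subset n
tupleSet v = image v (tabulate (λ _ → true))

homH : {k : ℕ} (m : ℕ) → List (Subset m) → UHypergraph k → ℕ
homH m es H = sumMaps ℕ._+_ 0 m (n H) (λ φ →
  if List.foldr (λ e acc → E H (image φ e) ∧ acc) true es then 1 else 0)

-- The r-intersection pattern hypergraph F^(r).
-- Vertex set: Fin (V + |E| * r); vertex v ∈ V is  v ↑ˡ _ , and
-- w_{e,i} is  V ↑ʳ combine e i  (e the index of the edge in the list).

patternV : (r : ℕ) → SimpleGraph → ℕ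
patternV r F = V F ℕ.+ numEdges F ℕ.* r

patternE : (r : ℕ) (F : SimpleGraph) → List (Subset (patternV r F))
patternE r F = List.concat (List.tabulate {n = numEdges F} λ e →
    let (u , v) = List.lookup (edges F) e
        W = ⋃ (List.tabulate {n = r} (λ i → ⁅ V F ↑ʳ combine e i ⁆))
    in (⁅ v ↑ˡ (numEdges F ℕ.* r) ⁆ ∪ W) ∷ (⁅ u ↑ˡ (numEdges F ℕ.* r) ⁆ ∪ W) ∷ [])

adjT : {r : ℕ} (H : UHypergraph (suc r)) → (Fin (suc r) → Fin (n H)) → ℚ
adjT H v = if E H (tupleSet v) then ℚ.1ℚ else ℚ.0ℚ

snoc : {A : Set} {r : ℕ} → (Fin r → A) → A → Fin (suc r) → A
snoc {r = zero}  i v _       = v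
snoc {r = suc r} i v Fin.zero    = i Fin.zero
snoc {r = suc r} i v (Fin.suc x) = snoc (λ y → i (Fin.suc y)) v x

B : (r : ℕ) (H : UHypergraph (suc r)) → Fin (n H) → Fin (n H) → ℚ
B r H u v = ((+ 1) ℚ./ (r !)) {{r !≢0}} ℚ.* sumMaps ℚ._+_ ℚ.0ℚ r (n H)
  (λ i → adjT H (u ∷ᶠ i) ℚ.* adjT H (snoc i v))

homW : (F : SimpleGraph) {N : ℕ} → (Fin N → Fin N → ℚ) → ℚ
homW F {N} M = sumMaps ℚ._+_ ℚ.0ℚ (V F) N (λ φ →
  List.foldr (λ { (u , v) acc → M (φ u) (φ v) ℚ.* acc }) ℚ.1ℚ (edges F))

ℕ→ℚ : ℕ → ℚ
ℕ→ℚ k = (+ k) ℚ./ 1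

{-# OPTIONS --safe #-}
-- A map F^(r) → H is a pair of maps: g on the vertices of F, and for every
-- edge e = {u,v} of F an r-tuple w_e on the vertices w_{e,1},…,w_{e,r}.  It is
-- a homomorphism iff for every e both g u ∷ w_e and g v ∷ w_e span edges of H.
-- These conditions concern disjoint blocks of variables, so for fixed g the sum
-- over the tuples factorises into a product over the edges of F of the number
-- of tuples w with u ∷ w and v ∷ w both spanning edges.  That number is
-- Σ_w A(u,w) A(w,v) = r! B[H]_{uv}, because A is a symmetric tensor.
module Submission where

open import Defs
open import Algebra.Bundles using (CommutativeMonoid)
import Algebra.Properties.CommutativeSemigroup as CommutativeSemigroupProperties
open import Data.Bool using (Bool; true; false; T; if_then_else_; _∧_; _∨_)
open import Data.Bool.Properties using (T-≡; T-∧; ∧-assoc; ∧-identityʳ)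
open import Data.Empty using (⊥-elim)
open import Data.Fin using (Fin; zero; suc; _↑ˡ_; _↑ʳ_; combine; _≟_)
open import Data.Fin.Subset using (Subset; _∈_; _⊆_; ⁅_⁆; _∪_; ⋃)
open import Data.Fin.Subset.Properties using (⊆-antisym; x∈⁅x⁆; x∈⁅y⁆⇒x≡y; x∈p∪q⁻; x∈p∪q⁺; ∉⊥)
open import Data.Integer as ℤ using (+_)
import Data.Integer.Properties as ℤₚ
open import Data.Bool.ListAction using (any)
open import Data.List as List using (List; []; _∷_; _++_; concat; map; allFin)
open import Data.List.Properties using (foldr-cong; foldr-fusion; foldr-map; map-tabulate; tabulate-cong)
open import Data.List.Relation.Unary.Any using (Any; here; there)
import Data.List.Relation.Unary.Any.Properties as Anyₚ
open import Data.Nat as ℕ using (ℕ; zero; suc; _≤_; _!; _^_; NonZero)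
import Data.Nat.Coprimality as Coprime
open import Data.Nat.ListAction using (product)
import Data.Nat.Properties as ℕₚ
open import Data.Nat.Properties using (_!≢0)
open import Data.Product using (_×_; _,_; ∃)
open import Data.Rational as ℚ using (ℚ; mkℚ; 0ℚ; 1ℚ; _+_; _*_)
import Data.Rational.Properties as ℚₚ
open import Data.Sum using (inj₁; inj₂; [_,_]′)
open import Data.Vec using (tabulate; lookup)
open import Data.Vec.Properties using (lookup∘tabulate; []=⇒lookup; lookup⇒[]=)
open import Data.Vec.Functional using () renaming (_∷_ to _∷ᶠ_)
open import Function using (_∘_; Equivalence)
open import Relation.Nullary.Decidable using (⌊_⌋; toWitness; fromWitness)
open import Relation.Binary.PropositionalEquality using (_≡_; refl; sym; trans; cong; cong₂; subst; module ≡-Reasoning)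

-- Unlike Data.Vec.Functional._++_ this recurses on the first length, so that
-- (j ∷ᶠ g) ++ᶠ h and j ∷ᶠ (g ++ᶠ h) agree definitionally.
_++ᶠ_ : {X : Set} {a b : ℕ} → (Fin a → X) → (Fin b → X) → Fin (a ℕ.+ b) → X
_++ᶠ_ {a = zero}  g h = h
_++ᶠ_ {a = suc a} g h = g zero ∷ᶠ ((g ∘ suc) ++ᶠ h)

++ᶠ-↑ˡ : {X : Set} {a b : ℕ} (g : Fin a → X) (h : Fin b → X) (i : Fin a) → (g ++ᶠ h) (i ↑ˡ b) ≡ g i
++ᶠ-↑ˡ g h zero    = refl
++ᶠ-↑ˡ g h (suc i) = ++ᶠ-↑ˡ (g ∘ suc) h i

++ᶠ-↑ʳ : {X : Set} {a b : ℕ} (g : Fin a → X) (h : Fin b → X) (j : Fin b) → (g ++ᶠ h) (a ↑ʳ j) ≡ h j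
++ᶠ-↑ʳ {a = zero}  g h j = refl
++ᶠ-↑ʳ {a = suc a} g h j = ++ᶠ-↑ʳ (g ∘ suc) h j

module _ {A : Set} (_⊕_ : A → A → A) (ε : A) where

  sumFin-cong : ∀ n {f g : Fin n → A} → (∀ j → f j ≡ g j) →
                sumFin _⊕_ ε n f ≡ sumFin _⊕_ ε n g
  sumFin-cong n f≗g = foldr-cong (λ j acc → cong (_⊕ acc) (f≗g j)) refl (allFin n)

  sumMaps-cong : ∀ m n {f g : (Fin m → Fin n) → A} → (∀ φ → f φ ≡ g φ) →
                 sumMaps _⊕_ ε m n f ≡ sumMaps _⊕_ ε m n g
  sumMaps-cong zero    n f≗g = f≗g _
  sumMaps-cong (suc m) n f≗g = sumFin-cong n (λ j → sumMaps-cong m n (λ φ → f≗g (j ∷ᶠ φ)))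

  sumMaps-++ : ∀ (a b n : ℕ) (f : (Fin (a ℕ.+ b) → Fin n) → A) →
               sumMaps _⊕_ ε (a ℕ.+ b) n f
                 ≡ sumMaps _⊕_ ε a n (λ g → sumMaps _⊕_ ε b n (λ h → f (g ++ᶠ h)))
  sumMaps-++ zero    b n f = refl
  sumMaps-++ (suc a) b n f = sumFin-cong n (λ j → sumMaps-++ a b n (λ φ → f (j ∷ᶠ φ)))

module _ {A B : Set} {_⊕_ : A → A → A} {ε : A} {_⊞_ : B → B → B} {ε′ : B}
         (h : A → B) (h-ε : h ε ≡ ε′) (h-⊕ : ∀ x y → h (x ⊕ y) ≡ h x ⊞ h y) where

  sumFin-hom : ∀ n (f : Fin n → A) → h (sumFin _⊕_ ε n f) ≡ sumFin _⊞_ ε′ n (h ∘ f)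
  sumFin-hom n f = trans (foldr-fusion h ε (λ j acc → h-⊕ (f j) acc) (allFin n))
                         (foldr-cong (λ _ _ → refl) h-ε (allFin n))

  sumMaps-hom : ∀ m n (f : (Fin m → Fin n) → A) →
                h (sumMaps _⊕_ ε m n f) ≡ sumMaps _⊞_ ε′ m n (h ∘ f)
  sumMaps-hom zero    n f = refl
  sumMaps-hom (suc m) n f = trans (sumFin-hom n (λ j → sumMaps _⊕_ ε m n (λ φ → f (j ∷ᶠ φ))))
                                  (sumFin-cong _⊞_ ε′ n (λ j → sumMaps-hom m n (λ φ → f (j ∷ᶠ φ))))

sumMapsℕ : (m n : ℕ) → ((Fin m → Fin n) → ℕ) → ℕ
sumMapsℕ = sumMaps ℕ._+_ 0

*-distribˡ-sumMapsℕ : ∀ m n c (f : (Fin m → Fin n) → ℕ) →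
                      c ℕ.* sumMapsℕ m n f ≡ sumMapsℕ m n (λ φ → c ℕ.* f φ)
*-distribˡ-sumMapsℕ m n c = sumMaps-hom (c ℕ.*_) (ℕₚ.*-zeroʳ c) (ℕₚ.*-distribˡ-+ c) m n

*-distribʳ-sumMapsℕ : ∀ m n c (f : (Fin m → Fin n) → ℕ) →
                      sumMapsℕ m n f ℕ.* c ≡ sumMapsℕ m n (λ φ → f φ ℕ.* c)
*-distribʳ-sumMapsℕ m n c = sumMaps-hom (ℕ._* c) refl (ℕₚ.*-distribʳ-+ c) m n

block : {X : Set} {m r : ℕ} → Fin m → (Fin (m ℕ.* r) → X) → Fin r → X
block e h i = h (combine e i)

sumMaps-product-blocks : ∀ m r N (Q : Fin m → (Fin r → Fin N) → ℕ) →
  (∀ e {w w′} → (∀ i → w i ≡ w′ i) → Q e w ≡ Q e w′) →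
  sumMapsℕ (m ℕ.* r) N (λ h → product (List.tabulate (λ e → Q e (block e h))))
    ≡ product (List.tabulate (λ e → sumMapsℕ r N (Q e)))
sumMaps-product-blocks zero    r N Q Q-ext = refl
sumMaps-product-blocks (suc m) r N Q Q-ext = begin
  sumMapsℕ (r ℕ.+ m ℕ.* r) N (λ h → Q zero (block {m = suc m} zero h) ℕ.* rest h)
    ≡⟨ sumMaps-++ ℕ._+_ 0 r (m ℕ.* r) N _ ⟩
  sumMapsℕ r N (λ g → sumMapsℕ (m ℕ.* r) N (λ h →
    Q zero (block {m = suc m} zero (g ++ᶠ h)) ℕ.* rest (g ++ᶠ h)))
    ≡⟨ sumMaps-cong ℕ._+_ 0 r N (λ g → sumMaps-cong ℕ._+_ 0 (m ℕ.* r) N (λ h → cong₂ ℕ._*_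
         (Q-ext zero (++ᶠ-↑ˡ {b = m ℕ.* r} g h))
         (cong product (tabulate-cong (λ e → Q-ext (suc e) (λ i → ++ᶠ-↑ʳ g h (combine e i))))))) ⟩
  sumMapsℕ r N (λ g → sumMapsℕ (m ℕ.* r) N (λ h → Q zero g ℕ.* rest′ h))
    ≡⟨ sumMaps-cong ℕ._+_ 0 r N (λ g → sym (*-distribˡ-sumMapsℕ (m ℕ.* r) N (Q zero g) rest′)) ⟩
  sumMapsℕ r N (λ g → Q zero g ℕ.* sumMapsℕ (m ℕ.* r) N rest′)
    ≡⟨ sym (*-distribʳ-sumMapsℕ r N _ (Q zero)) ⟩
  sumMapsℕ r N (Q zero) ℕ.* sumMapsℕ (m ℕ.* r) N rest′
    ≡⟨ cong (sumMapsℕ r N (Q zero) ℕ.*_) (sumMaps-product-blocks m r N (Q ∘ suc) (Q-ext ∘ suc)) ⟩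
  product (List.tabulate (λ e → sumMapsℕ r N (Q e))) ∎
  where
  open ≡-Reasoning
  rest : (Fin (suc m ℕ.* r) → Fin N) → ℕ
  rest h = product (List.tabulate (λ e → Q (suc e) (block (suc e) h)))
  rest′ : (Fin (m ℕ.* r) → Fin N) → ℕ
  rest′ h = product (List.tabulate (λ e → Q (suc e) (block e h)))

product-tabulate-lookup : {X : Set} (G : X → ℕ) (xs : List X) →
  product (List.tabulate (G ∘ List.lookup xs)) ≡ List.foldr (λ x acc → G x ℕ.* acc) 1 xs
product-tabulate-lookup G []       = refl
product-tabulate-lookup G (x ∷ xs) = cong (G x ℕ.*_) (product-tabulate-lookup G xs)

𝟙 : Bool → ℕ
𝟙 b = if b then 1 else 0

𝟙-∧ : ∀ a b → 𝟙 (a ∧ b) ≡ 𝟙 a ℕ.* 𝟙 b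
𝟙-∧ true  b = sym (ℕₚ.+-identityʳ (𝟙 b))
𝟙-∧ false b = refl

∈⇒T : {n : ℕ} {x : Fin n} {p : Subset n} → x ∈ p → T (lookup p x)
∈⇒T x∈p = Equivalence.from T-≡ ([]=⇒lookup x∈p)

T⇒∈ : {n : ℕ} {x : Fin n} {p : Subset n} → T (lookup p x) → x ∈ p
T⇒∈ {x = x} {p} t = lookup⇒[]= x p (Equivalence.to T-≡ t)

lookup-image : {m n : ℕ} (φ : Fin m → Fin n) (S : Subset m) (j : Fin n) →
  lookup (image φ S) j ≡ any (λ i → lookup S i ∧ ⌊ φ i ≟ j ⌋) (allFin m)
lookup-image {m} φ S j = trans (lookup∘tabulate _ j) (sym (foldr-map _∨_ _ false (allFin m)))

∈-image⁻ : {m n : ℕ} {φ : Fin m → Fin n} {S : Subset m} {j : Fin n} →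
  j ∈ image φ S → ∃ λ i → i ∈ S × φ i ≡ j
∈-image⁻ {m} {φ = φ} {S} {j} j∈ =
  let i , t      = Anyₚ.tabulate⁻ (Anyₚ.any⁻ _ (allFin m) (subst T (lookup-image φ S j) (∈⇒T j∈)))
      i∈S , φi≟j = Equivalence.to T-∧ t
  in  i , T⇒∈ i∈S , toWitness φi≟j

∈-image⁺ : {m n : ℕ} {φ : Fin m → Fin n} {S : Subset m} {i : Fin m} {j : Fin n} →
  i ∈ S → φ i ≡ j → j ∈ image φ S
∈-image⁺ {φ = φ} {S} {i} {j} i∈S refl =
  T⇒∈ (subst T (sym (lookup-image φ S j))
    (Anyₚ.any⁺ _ (Anyₚ.tabulate⁺ i (Equivalence.from T-∧ (∈⇒T i∈S , fromWitness refl)))))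

image-⊆ : {m m′ n : ℕ} {φ : Fin m → Fin n} {ψ : Fin m′ → Fin n} {S : Subset m} {S′ : Subset m′} →
  (∀ {i} → i ∈ S → ∃ λ k → k ∈ S′ × ψ k ≡ φ i) → image φ S ⊆ image ψ S′
image-⊆ φ⊆ψ j∈ =
  let i , i∈S , φi≡j = ∈-image⁻ j∈
      k , k∈S′ , ψk≡φi = φ⊆ψ i∈S
  in  ∈-image⁺ k∈S′ (trans ψk≡φi φi≡j)

image-≡ : {m m′ n : ℕ} {φ : Fin m → Fin n} {ψ : Fin m′ → Fin n} {S : Subset m} {S′ : Subset m′} →
  (∀ {i} → i ∈ S → ∃ λ k → k ∈ S′ × ψ k ≡ φ i) →
  (∀ {k} → k ∈ S′ → ∃ λ i → i ∈ S × φ i ≡ ψ k) →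
  image φ S ≡ image ψ S′
image-≡ φ⊆ψ ψ⊆φ = ⊆-antisym (image-⊆ φ⊆ψ) (image-⊆ ψ⊆φ)

∈-allTrue : {n : ℕ} (i : Fin n) → i ∈ tabulate (λ _ → true)
∈-allTrue i = lookup⇒[]= i _ (lookup∘tabulate _ i)

tupleSet-≡ : {k k′ n : ℕ} (w : Fin k → Fin n) (w′ : Fin k′ → Fin n) →
  (∀ i → ∃ λ i′ → w′ i′ ≡ w i) → (∀ i′ → ∃ λ i → w i ≡ w′ i′) → tupleSet w ≡ tupleSet w′
tupleSet-≡ w w′ w⊆w′ w′⊆w = image-≡
  (λ {i} _ → let i′ , eq = w⊆w′ i in i′ , ∈-allTrue i′ , eq)
  (λ {i′} _ → let i , eq = w′⊆w i′ in i , ∈-allTrue i , eq)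

tupleSet-cong : {k n : ℕ} {w w′ : Fin k → Fin n} → (∀ i → w i ≡ w′ i) → tupleSet w ≡ tupleSet w′
tupleSet-cong w≗w′ = tupleSet-≡ _ _ (λ i → i , sym (w≗w′ i)) (λ i → i , w≗w′ i)

∈-⋃⁻ : {n : ℕ} {x : Fin n} (ps : List (Subset n)) → x ∈ ⋃ ps → Any (x ∈_) ps
∈-⋃⁻ []       x∈ = ⊥-elim (∉⊥ x∈)
∈-⋃⁻ (p ∷ ps) x∈ = [ here , there ∘ ∈-⋃⁻ ps ]′ (x∈p∪q⁻ p (⋃ ps) x∈)

∈-⋃⁺ : {n : ℕ} {x : Fin n} {ps : List (Subset n)} → Any (x ∈_) ps → x ∈ ⋃ ps
∈-⋃⁺ (here x∈p)   = x∈p∪q⁺ (inj₁ x∈p)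
∈-⋃⁺ (there x∈ps) = x∈p∪q⁺ (inj₂ (∈-⋃⁺ x∈ps))

snoc-last : {X : Set} (r : ℕ) (w : Fin r → X) (b : X) → ∃ λ i → snoc w b i ≡ b
snoc-last zero    w b = zero , refl
snoc-last (suc r) w b = let i , eq = snoc-last r (w ∘ suc) b in suc i , eq

snoc-init : {X : Set} (r : ℕ) (w : Fin r → X) (b : X) (k : Fin r) → ∃ λ i → snoc w b i ≡ w k
snoc-init (suc r) w b zero    = zero , refl
snoc-init (suc r) w b (suc k) = let i , eq = snoc-init r (w ∘ suc) b k in suc i , eq

snoc-values : {X : Set} (r : ℕ) (w : Fin r → X) (b : X) (i : Fin (suc r)) →
  ∃ λ k → (b ∷ᶠ w) k ≡ snoc w b i
snoc-values zero    w b i       = zero , refl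
snoc-values (suc r) w b zero    = suc zero , refl
snoc-values (suc r) w b (suc i) with snoc-values r (w ∘ suc) b i
... | zero  , eq = zero , eq
... | suc k , eq = suc (suc k) , eq

tupleSet-snoc : {r n : ℕ} (w : Fin r → Fin n) (b : Fin n) → tupleSet (snoc w b) ≡ tupleSet (b ∷ᶠ w)
tupleSet-snoc {r} w b = tupleSet-≡ (snoc w b) (b ∷ᶠ w) (snoc-values r w b) values
  where
  values : ∀ k → ∃ λ i → snoc w b i ≡ (b ∷ᶠ w) k
  values zero    = snoc-last r w b
  values (suc k) = snoc-init r w b k

isHom : {k m : ℕ} (H : UHypergraph k) → (Fin m → Fin (n H)) → List (Subset m) → Bool
isHom H φ = List.foldr (λ S acc → E H (image φ S) ∧ acc) true

isHom-++ : {k m : ℕ} (H : UHypergraph k) (φ : Fin m → Fin (n H)) (xs ys : List (Subset m)) →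
  isHom H φ (xs ++ ys) ≡ isHom H φ xs ∧ isHom H φ ys
isHom-++ H φ []       ys = refl
isHom-++ H φ (x ∷ xs) ys =
  trans (cong (E H (image φ x) ∧_) (isHom-++ H φ xs ys)) (sym (∧-assoc (E H (image φ x)) _ _))

𝟙-isHom-concat : {k m : ℕ} (H : UHypergraph k) (φ : Fin m → Fin (n H)) (xss : List (List (Subset m))) →
  𝟙 (isHom H φ (concat xss)) ≡ product (map (𝟙 ∘ isHom H φ) xss)
𝟙-isHom-concat H φ []         = refl
𝟙-isHom-concat H φ (xs ∷ xss) = begin
  𝟙 (isHom H φ (xs ++ concat xss))              ≡⟨ cong 𝟙 (isHom-++ H φ xs (concat xss)) ⟩
  𝟙 (isHom H φ xs ∧ isHom H φ (concat xss))     ≡⟨ 𝟙-∧ (isHom H φ xs) _ ⟩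
  𝟙 (isHom H φ xs) ℕ.* 𝟙 (isHom H φ (concat xss)) ≡⟨ cong (𝟙 (isHom H φ xs) ℕ.*_) (𝟙-isHom-concat H φ xss) ⟩
  product (map (𝟙 ∘ isHom H φ) (xs ∷ xss))      ∎
  where open ≡-Reasoning

-- The subset below is the hyperedge {v, w_{e,1}, …, w_{e,r}} of F^(r).
image-patternHyperedge : {V m r n : ℕ} (g : Fin V → Fin n) (h : Fin (m ℕ.* r) → Fin n)
  (v : Fin V) (e : Fin m) →
  image (g ++ᶠ h) (⁅ v ↑ˡ (m ℕ.* r) ⁆ ∪ ⋃ (List.tabulate {n = r} (λ i → ⁅ V ↑ʳ combine e i ⁆)))
    ≡ tupleSet (g v ∷ᶠ block e h)
image-patternHyperedge {V} {m} {r} g h v e = image-≡ forward backward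
  where
  X W : Subset (V ℕ.+ m ℕ.* r)
  X = ⁅ v ↑ˡ (m ℕ.* r) ⁆
  W = ⋃ (List.tabulate {n = r} (λ i → ⁅ V ↑ʳ combine e i ⁆))
  forward : ∀ {x} → x ∈ X ∪ W →
    ∃ λ k → k ∈ tabulate (λ _ → true) × (g v ∷ᶠ block e h) k ≡ (g ++ᶠ h) x
  forward x∈ with x∈p∪q⁻ X W x∈
  ... | inj₁ x∈X rewrite x∈⁅y⁆⇒x≡y _ x∈X = zero , ∈-allTrue zero , sym (++ᶠ-↑ˡ g h v)
  ... | inj₂ x∈W with Anyₚ.tabulate⁻ (∈-⋃⁻ _ x∈W)
  ...   | i , x∈wᵢ rewrite x∈⁅y⁆⇒x≡y _ x∈wᵢ =
    suc i , ∈-allTrue (suc i) , sym (++ᶠ-↑ʳ g h (combine e i))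
  backward : ∀ {k} → k ∈ tabulate (λ _ → true) →
    ∃ λ x → x ∈ X ∪ W × (g ++ᶠ h) x ≡ (g v ∷ᶠ block e h) k
  backward {zero}  _ = v ↑ˡ (m ℕ.* r) , x∈p∪q⁺ (inj₁ (x∈⁅x⁆ _)) , ++ᶠ-↑ˡ g h v
  backward {suc i} _ =
    V ↑ʳ combine e i , x∈p∪q⁺ (inj₂ (∈-⋃⁺ (Anyₚ.tabulate⁺ i (x∈⁅x⁆ _)))) , ++ᶠ-↑ʳ g h (combine e i)

adjTℕ : {k : ℕ} (H : UHypergraph k) → (Fin k → Fin (n H)) → ℕ
adjTℕ H w = 𝟙 (E H (tupleSet w))

sharedLink : {r : ℕ} (H : UHypergraph (suc r)) → Fin (n H) → Fin (n H) → (Fin r → Fin (n H)) → ℕ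
sharedLink H a b w = adjTℕ H (a ∷ᶠ w) ℕ.* adjTℕ H (b ∷ᶠ w)

sharedLink-cong : {r : ℕ} (H : UHypergraph (suc r)) (a b : Fin (n H)) {w w′ : Fin r → Fin (n H)} →
  (∀ i → w i ≡ w′ i) → sharedLink H a b w ≡ sharedLink H a b w′
sharedLink-cong H a b w≗w′ = cong₂ (λ S S′ → 𝟙 (E H S) ℕ.* 𝟙 (E H S′))
  (tupleSet-cong λ { zero → refl ; (suc i) → w≗w′ i })
  (tupleSet-cong λ { zero → refl ; (suc i) → w≗w′ i })

commonLinks : (r : ℕ) (H : UHypergraph (suc r)) → Fin (n H) → Fin (n H) → ℕ
commonLinks r H a b = sumMapsℕ r (n H) (sharedLink H a b)

edgeLink : {r : ℕ} (F : SimpleGraph) (H : UHypergraph (suc r)) →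
  (Fin (V F) → Fin (n H)) → Fin (numEdges F) → (Fin r → Fin (n H)) → ℕ
edgeLink F H g e = let (u , v) = List.lookup (edges F) e in sharedLink H (g u) (g v)

𝟙-isHom-pattern : (r : ℕ) (F : SimpleGraph) (H : UHypergraph (suc r))
  (g : Fin (V F) → Fin (n H)) (h : Fin (numEdges F ℕ.* r) → Fin (n H)) →
  𝟙 (isHom H (g ++ᶠ h) (patternE r F)) ≡ product (List.tabulate (λ e → edgeLink F H g e (block e h)))
𝟙-isHom-pattern r F H g h =
  trans (𝟙-isHom-concat H (g ++ᶠ h) (List.tabulate pair))
        (trans (cong product (map-tabulate pair (𝟙 ∘ isHom H (g ++ᶠ h))))
               (cong product (tabulate-cong (λ e → edgeFactor e _ _))))
  where
  open ≡-Reasoning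
  hyperedge : Fin (V F) → Fin (numEdges F) → Subset (patternV r F)
  hyperedge x e = ⁅ x ↑ˡ (numEdges F ℕ.* r) ⁆ ∪ ⋃ (List.tabulate {n = r} (λ i → ⁅ V F ↑ʳ combine e i ⁆))
  pair : Fin (numEdges F) → List (Subset (patternV r F))
  pair e = let (u , v) = List.lookup (edges F) e in hyperedge v e ∷ hyperedge u e ∷ []
  edgeFactor : ∀ e (u v : Fin (V F)) →
    𝟙 (isHom H (g ++ᶠ h) (hyperedge v e ∷ hyperedge u e ∷ [])) ≡ sharedLink H (g u) (g v) (block e h)
  edgeFactor e u v = begin
    𝟙 (E H (image (g ++ᶠ h) (hyperedge v e)) ∧ (E H (image (g ++ᶠ h) (hyperedge u e)) ∧ true))
      ≡⟨ cong₂ (λ S S′ → 𝟙 (E H S ∧ (E H S′ ∧ true)))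
               (image-patternHyperedge g h v e) (image-patternHyperedge g h u e) ⟩
    𝟙 (E H (tupleSet (g v ∷ᶠ block e h)) ∧ (E H (tupleSet (g u ∷ᶠ block e h)) ∧ true))
      ≡⟨ cong (λ b → 𝟙 (E H (tupleSet (g v ∷ᶠ block e h)) ∧ b)) (∧-identityʳ _) ⟩
    𝟙 (E H (tupleSet (g v ∷ᶠ block e h)) ∧ E H (tupleSet (g u ∷ᶠ block e h)))
      ≡⟨ 𝟙-∧ (E H (tupleSet (g v ∷ᶠ block e h))) (E H (tupleSet (g u ∷ᶠ block e h))) ⟩
    adjTℕ H (g v ∷ᶠ block e h) ℕ.* adjTℕ H (g u ∷ᶠ block e h)
      ≡⟨ ℕₚ.*-comm (adjTℕ H (g v ∷ᶠ block e h)) (adjTℕ H (g u ∷ᶠ block e h)) ⟩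
    sharedLink H (g u) (g v) (block e h) ∎

homℕ : (F : SimpleGraph) {N : ℕ} → (Fin N → Fin N → ℕ) → ℕ
homℕ F {N} M = sumMapsℕ (V F) N (λ φ → List.foldr (λ { (u , v) acc → M (φ u) (φ v) ℕ.* acc }) 1 (edges F))

homH-pattern : (r : ℕ) (F : SimpleGraph) (H : UHypergraph (suc r)) →
  homH (patternV r F) (patternE r F) H ≡ homℕ F (commonLinks r H)
homH-pattern r F H = begin
  sumMapsℕ (V F ℕ.+ m ℕ.* r) N (λ φ → 𝟙 (isHom H φ (patternE r F)))
    ≡⟨ sumMaps-++ ℕ._+_ 0 (V F) (m ℕ.* r) N _ ⟩
  sumMapsℕ (V F) N (λ g → sumMapsℕ (m ℕ.* r) N (λ h → 𝟙 (isHom H (g ++ᶠ h) (patternE r F))))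
    ≡⟨ sumMaps-cong ℕ._+_ 0 (V F) N (λ g → sumMaps-cong ℕ._+_ 0 (m ℕ.* r) N (𝟙-isHom-pattern r F H g)) ⟩
  sumMapsℕ (V F) N (λ g → sumMapsℕ (m ℕ.* r) N (λ h → product (List.tabulate (λ e → edgeLink F H g e (block e h)))))
    ≡⟨ sumMaps-cong ℕ._+_ 0 (V F) N (λ g →
         sumMaps-product-blocks m r N (edgeLink F H g) (λ e → sharedLink-cong H _ _)) ⟩
  sumMapsℕ (V F) N (λ g → product (List.tabulate (λ e → sumMapsℕ r N (edgeLink F H g e))))
    ≡⟨ sumMaps-cong ℕ._+_ 0 (V F) N (λ g →
         product-tabulate-lookup (λ (u , v) → commonLinks r H (g u) (g v)) (edges F)) ⟩
  homℕ F (commonLinks r H) ∎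
  where
  open ≡-Reasoning
  m N : ℕ
  m = numEdges F
  N = n H

ℕ→ℚ≡mkℚ : ∀ k → ℕ→ℚ k ≡ mkℚ (+ k) 0 (Coprime.sym (Coprime.1-coprimeTo k))
ℕ→ℚ≡mkℚ k = ℚₚ.normalize-coprime (Coprime.sym (Coprime.1-coprimeTo k))

ℕ→ℚ-+ : ∀ a b → ℕ→ℚ (a ℕ.+ b) ≡ ℕ→ℚ a + ℕ→ℚ b
ℕ→ℚ-+ a b = sym (trans (cong₂ _+_ (ℕ→ℚ≡mkℚ a) (ℕ→ℚ≡mkℚ b))
  (cong (ℚ._/ 1) (cong₂ ℤ._+_ (ℤₚ.*-identityʳ (+ a)) (ℤₚ.*-identityʳ (+ b)))))

ℕ→ℚ-* : ∀ a b → ℕ→ℚ (a ℕ.* b) ≡ ℕ→ℚ a * ℕ→ℚ b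
ℕ→ℚ-* a b = sym (trans (cong₂ _*_ (ℕ→ℚ≡mkℚ a) (ℕ→ℚ≡mkℚ b)) (cong (ℚ._/ 1) (sym (ℤₚ.pos-* a b))))

ℕ→ℚ-*-inverse : ∀ k .{{_ : NonZero k}} → ℕ→ℚ k * ((+ 1) ℚ./ k) ≡ 1ℚ
ℕ→ℚ-*-inverse (suc k) = trans
  (cong₂ _*_ (ℕ→ℚ≡mkℚ (suc k)) (ℚₚ.normalize-coprime (Coprime.1-coprimeTo (suc k))))
  (ℚₚ.*-inverseʳ (mkℚ (+ suc k) 0 (Coprime.sym (Coprime.1-coprimeTo (suc k)))))

ℕ→ℚ-sumMaps : ∀ m n (f : (Fin m → Fin n) → ℕ) →
              ℕ→ℚ (sumMapsℕ m n f) ≡ sumMaps _+_ 0ℚ m n (ℕ→ℚ ∘ f)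
ℕ→ℚ-sumMaps = sumMaps-hom ℕ→ℚ refl ℕ→ℚ-+

adjT≡ℕ→ℚ-adjTℕ : {k : ℕ} (H : UHypergraph (suc k)) (w : Fin (suc k) → Fin (n H)) →
                 adjT H w ≡ ℕ→ℚ (adjTℕ H w)
adjT≡ℕ→ℚ-adjTℕ H w with E H (tupleSet w)
... | true  = refl
... | false = refl

r!*B≡commonLinks : (r : ℕ) (H : UHypergraph (suc r)) (a b : Fin (n H)) →
  ℕ→ℚ (r !) * B r H a b ≡ ℕ→ℚ (commonLinks r H a b)
r!*B≡commonLinks r H a b = begin
  ℕ→ℚ (r !) * (1/r! * S)                          ≡⟨ sym (ℚₚ.*-assoc (ℕ→ℚ (r !)) 1/r! S) ⟩
  ℕ→ℚ (r !) * 1/r! * S                            ≡⟨ cong (_* S) (ℕ→ℚ-*-inverse (r !) {{r !≢0}}) ⟩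
  1ℚ * S                                          ≡⟨ ℚₚ.*-identityˡ S ⟩
  S                                               ≡⟨ sumMaps-cong _+_ 0ℚ r (n H) term ⟩
  sumMaps _+_ 0ℚ r (n H) (ℕ→ℚ ∘ sharedLink H a b) ≡⟨ sym (ℕ→ℚ-sumMaps r (n H) (sharedLink H a b)) ⟩
  ℕ→ℚ (commonLinks r H a b)                       ∎
  where
  open ≡-Reasoning
  1/r! : ℚ
  1/r! = ((+ 1) ℚ./ (r !)) {{r !≢0}}
  S : ℚ
  S = sumMaps _+_ 0ℚ r (n H) (λ w → adjT H (a ∷ᶠ w) * adjT H (snoc w b))
  term : ∀ w → adjT H (a ∷ᶠ w) * adjT H (snoc w b) ≡ ℕ→ℚ (sharedLink H a b w)
  term w = begin
    adjT H (a ∷ᶠ w) * adjT H (snoc w b)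
      ≡⟨ cong₂ _*_ (adjT≡ℕ→ℚ-adjTℕ H (a ∷ᶠ w)) (adjT≡ℕ→ℚ-adjTℕ H (snoc w b)) ⟩
    ℕ→ℚ (adjTℕ H (a ∷ᶠ w)) * ℕ→ℚ (adjTℕ H (snoc w b))
      ≡⟨ cong (λ T → ℕ→ℚ (adjTℕ H (a ∷ᶠ w)) * ℕ→ℚ (𝟙 (E H T))) (tupleSet-snoc w b) ⟩
    ℕ→ℚ (adjTℕ H (a ∷ᶠ w)) * ℕ→ℚ (adjTℕ H (b ∷ᶠ w))
      ≡⟨ sym (ℕ→ℚ-* (adjTℕ H (a ∷ᶠ w)) (adjTℕ H (b ∷ᶠ w))) ⟩
    ℕ→ℚ (sharedLink H a b w) ∎

ℕ→ℚ-homℕ : (F : SimpleGraph) {N : ℕ} (M : Fin N → Fin N → ℕ) →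
           ℕ→ℚ (homℕ F M) ≡ homW F (λ a b → ℕ→ℚ (M a b))
ℕ→ℚ-homℕ F {N} M = trans (ℕ→ℚ-sumMaps (V F) N _) (sumMaps-cong _+_ 0ℚ (V F) N (λ φ →
  foldr-fusion ℕ→ℚ 1 (λ (u , v) acc → ℕ→ℚ-* (M (φ u) (φ v)) acc) (edges F)))

homW-cong : (F : SimpleGraph) {N : ℕ} {M M′ : Fin N → Fin N → ℚ} →
            (∀ a b → M a b ≡ M′ a b) → homW F M ≡ homW F M′
homW-cong F {N} M≗M′ = sumMaps-cong _+_ 0ℚ (V F) N (λ φ →
  foldr-cong (λ (u , v) acc → cong (_* acc) (M≗M′ (φ u) (φ v))) refl (edges F))

homW-scale : (F : SimpleGraph) {N : ℕ} (k : ℕ) (M : Fin N → Fin N → ℚ) →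
  ℕ→ℚ (k ^ numEdges F) * homW F M ≡ homW F (λ a b → ℕ→ℚ k * M a b)
homW-scale F {N} k M = trans
  (sumMaps-hom (c *_) (ℚₚ.*-zeroʳ c) (ℚₚ.*-distribˡ-+ c) (V F) N _)
  (sumMaps-cong _+_ 0ℚ (V F) N (λ φ → scale (λ (u , v) → M (φ u) (φ v)) (edges F)))
  where
  open ≡-Reasoning
  open CommutativeSemigroupProperties (CommutativeMonoid.commutativeSemigroup ℚₚ.*-1-commutativeMonoid)
    using (interchange)
  c : ℚ
  c = ℕ→ℚ (k ^ numEdges F)
  scale : {X : Set} (G : X → ℚ) (xs : List X) →
    ℕ→ℚ (k ^ List.length xs) * List.foldr (λ x acc → G x * acc) 1ℚ xs
      ≡ List.foldr (λ x acc → (ℕ→ℚ k * G x) * acc) 1ℚ xs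
  scale G []       = ℚₚ.*-identityˡ 1ℚ
  scale G (x ∷ xs) = begin
    ℕ→ℚ (k ℕ.* kˡ) * (G x * rest)   ≡⟨ cong (_* (G x * rest)) (ℕ→ℚ-* k kˡ) ⟩
    ℕ→ℚ k * ℕ→ℚ kˡ * (G x * rest)   ≡⟨ interchange (ℕ→ℚ k) (ℕ→ℚ kˡ) (G x) rest ⟩
    ℕ→ℚ k * G x * (ℕ→ℚ kˡ * rest)   ≡⟨ cong (ℕ→ℚ k * G x *_) (scale G xs) ⟩
    ℕ→ℚ k * G x * List.foldr (λ x acc → (ℕ→ℚ k * G x) * acc) 1ℚ xs ∎
    where
    kˡ : ℕ
    kˡ = k ^ List.length xs
    rest : ℚ
    rest = List.foldr (λ x acc → G x * acc) 1ℚ xs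

mainTheorem6 : (r : ℕ) → 1 ≤ r → (F : SimpleGraph) → (H : UHypergraph (suc r)) →
    ℕ→ℚ (homH (patternV r F) (patternE r F) H)
      ≡ ℕ→ℚ ((r !) ^ numEdges F) * homW F (B r H)
mainTheorem6 r _ F H = begin
  ℕ→ℚ (homH (patternV r F) (patternE r F) H)     ≡⟨ cong ℕ→ℚ (homH-pattern r F H) ⟩
  ℕ→ℚ (homℕ F (commonLinks r H))                 ≡⟨ ℕ→ℚ-homℕ F (commonLinks r H) ⟩
  homW F (λ a b → ℕ→ℚ (commonLinks r H a b))     ≡⟨ homW-cong F (λ a b → sym (r!*B≡commonLinks r H a b)) ⟩
  homW F (λ a b → ℕ→ℚ (r !) * B r H a b)         ≡⟨ sym (homW-scale F (r !) (B r H)) ⟩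
  ℕ→ℚ ((r !) ^ numEdges F) * homW F (B r H)      ∎
  where open ≡-Reasoning
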